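{- Let $t\geq 3$ be an integer and suppose that every $PG(t-2,2)$-free matroid $M'$ with $|M'|>(1-3\cdot 2^{ -(t-1)})2^{r(M')}$ satisfies $\chi(M')\in\{t-2,t-1\}$. Let $M$ be a $PG(t-1,2)$-free matroid with $|M|>(1-3\cdot 2^{ -t})2^{r(M)}$ and $\chi(M)>t$, and set $Y=\mathbb{F}_2^{r(M)}\setminus E(M)$. Then for every hyperplane $H$ of $\mathbb{F}_2^{r(M)}$, $|Y\setminus H|\geq 2^{r(M)-t}$.
   Context: A matroid $M$ means a simple binary matroid, represented by an integer $r(M)\geq 0$ (its rank) and a set $E(M)\subseteq \mathbb{F}_2^{r(M)}\setminus\{0\}$ that spans $\mathbb{F}_2^{r(M)}$; $|M|:=|E(M)|$. The critical number $\chi(M)$ is the smallest $k$ such that some subspace of $\mathbb{F}_2^{r(M)}$ of codimension $k$ is disjoint from $E(M)$. A matroid $M$ contains a matroid $N$ if there is an injective linear map $\iota:\mathbb{F}_2^{r(N)}\to\mathbb{F}_2^{r(M)}$ with $\iota(E(N))\subseteq E(M)$; $M$ is $N$-free if it does not contain $N$. The projective geometry $PG(s-1,2)$ is the matroid of rank $s$ with edge set $\mathbb{F}_2^s\setminus\{0\}$. A hyperplane is a linear subspace of codimension 1. Note $0\in Y$. -}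

module Defs where

open import Data.Bool using (Bool; true; false; if_then_else_; _xor_; not)
open import Data.Bool.Properties using (xor-identityʳ)
open import Data.Nat using (ℕ; zero; suc; _+_; _*_; _^_)
open import Data.Vec using (Vec; []; _∷_; replicate; zipWith)
open import Data.List using (List; []; _∷_; map; _++_; foldr)
open import Data.Nat.ListAction using (sum)
open import Data.List.Relation.Unary.All as All using (All)
open import Data.Product using (Σ; _×_; ∃; ∃-syntax; _,_)
open import Relation.Binary.PropositionalEquality using (_≡_; _≢_; refl; cong; cong₂; sym)
open import Relation.Nullary using (¬_)

V : ℕ → Set
V n = Vec Bool n

0v : ∀ {n} → V n
0v = replicate _ false

_⊕_ : ∀ {n} → V n → V n → V n
_⊕_ = zipWith _xor_

allVecs : (n : ℕ) → List (V n)
allVecs zero = [] ∷ []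
allVecs (suc n) = map (false ∷_) (allVecs n) ++ map (true ∷_) (allVecs n)

count : ∀ {n} → (V n → Bool) → ℕ
count {n} P = sum (map (λ x → if P x then 1 else 0) (allVecs n))

vsum : ∀ {n} → List (V n) → V n
vsum = foldr _⊕_ 0v

Spans : ∀ {n} → (V n → Bool) → Set
Spans {n} X = (v : V n) → Σ (List (V n)) λ xs → All (λ x → X x ≡ true) xs × vsum xs ≡ v

-- simple binary matroid: rank r and edge set E ⊆ F_2^r \ {0} spanning F_2^r
record Matroid : Set where
  field
    r : ℕ
    E : V r → Bool
    zero∉E : E 0v ≡ false
    spans : Spans E
open Matroid public

∣_∣ₘ : Matroid → ℕ
∣ M ∣ₘ = count (E M)

record IsSubspace {n : ℕ} (S : V n → Bool) : Set where
  field
    has0 : S 0v ≡ true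
    closed : ∀ x y → S x ≡ true → S y ≡ true → S (x ⊕ y) ≡ true

HasCodim : ∀ {n} → (V n → Bool) → ℕ → Set
HasCodim {n} S k = count S * 2 ^ k ≡ 2 ^ n

Disjoint : ∀ {n} → (V n → Bool) → (V n → Bool) → Set
Disjoint {n} S X = (x : V n) → S x ≡ true → X x ≡ false

AvoidableAt : Matroid → ℕ → Set
AvoidableAt M k = Σ (V (r M) → Bool) λ S → IsSubspace S × HasCodim S k × Disjoint S (E M)

IsCriticalNumber : Matroid → ℕ → Set
IsCriticalNumber M k = AvoidableAt M k × (∀ j → j Data.Nat.< k → ¬ AvoidableAt M j)

IsLinear : ∀ {m n} → (V m → V n) → Set
IsLinear {m} f = ∀ x y → f (x ⊕ y) ≡ f x ⊕ f y

Injective : ∀ {m n} → (V m → V n) → Set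
Injective {m} f = ∀ x y → f x ≡ f y → x ≡ y

Contains : Matroid → Matroid → Set
Contains M N = Σ (V (r N) → V (r M)) λ ι →
  IsLinear ι × Injective ι × (∀ x → E N x ≡ true → E M (ι x) ≡ true)

Free : Matroid → Matroid → Set
Free M N = ¬ Contains M N

isNonzero : ∀ {n} → V n → Bool
isNonzero [] = false
isNonzero (b ∷ v) = if b then true else isNonzero v

isNonzero-0 : ∀ n → isNonzero (0v {n}) ≡ false
isNonzero-0 zero = refl
isNonzero-0 (suc n) = isNonzero-0 n

isNonzero-false : ∀ {n} (v : V n) → isNonzero v ≡ false → v ≡ 0v
isNonzero-false [] _ = refl
isNonzero-false (false ∷ v) p = cong (false ∷_) (isNonzero-false v p)
isNonzero-false (true ∷ v) ()

⊕-0 : ∀ {n} (v : V n) → v ⊕ 0v ≡ v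
⊕-0 [] = refl
⊕-0 (b ∷ v) = cong₂ _∷_ (xor-identityʳ b) (⊕-0 v)

PG-spans : ∀ s → Spans (isNonzero {s})
PG-spans s v with isNonzero v in eq
... | true = (v ∷ []) , (eq All.∷ All.[]) , ⊕-0 v
... | false = [] , All.[] , sym (isNonzero-false v eq)

PG : ℕ → Matroid
PG s = record { r = s ; E = isNonzero ; zero∉E = isNonzero-0 s ; spans = PG-spans s }

-- |M| > (1 - 3·2^{-s}) 2^{r(M)}, with denominators cleared (multiply by 2^s):
-- |M|·2^s + 3·2^{r(M)} > 2^{r(M)}·2^s
DenserThan : Matroid → ℕ → Set
DenserThan M s = 2 ^ r M * 2 ^ s Data.Nat.< ∣ M ∣ₘ * 2 ^ s + 3 * 2 ^ r M

IsHyperplane : ∀ {n} → (V n → Bool) → Set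
IsHyperplane H = IsSubspace H × HasCodim H 1

Y : (M : Matroid) → V (r M) → Bool
Y M x = not (E M x)

∣Y∖_∣ : (M : Matroid) → (V (r M) → Bool) → ℕ
∣Y∖_∣ M H = count (λ x → Y M x Data.Bool.∧ not (H x))

-- Suppose |Y ∖ H| < 2^{r-t}. If E ∩ H contained a copy ι of PG(t-2,2), then for each
-- x ∉ H the coset x + im ι would have to meet Y, for otherwise E would contain
-- PG(t-1,2); counting these incidences gives 2^{r-1} = |F₂ʳ ∖ H| ≤ 2^{t-1}·|Y ∖ H|, a
-- contradiction. So E ∩ H, read in coordinates H ≅ F₂^{r-1}, is PG(t-2,2)-free and at
-- least as dense as E; it spans when t ≥ 4, and for t = 3 it is sum-free and can be
-- enlarged to a spanning sum-free set. The hypothesis then gives a subspace of H of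
-- codimension at most t-1 avoiding it, which has codimension at most t in F₂ʳ and avoids
-- E, contradicting χ(M) > t. Rank r ≤ t is excluded directly, since then {0} avoids E.

module Submission where

open import Defs
open import Algebra.Properties.CommutativeSemigroup using (interchange)
open import Data.Bool as Bool using (Bool; true; false; if_then_else_; _xor_; not; _∧_; _∨_)
open import Data.Bool.Properties using (xor-comm; xor-assoc; xor-same; not-injective; ¬-not; ∧-identityʳ; ∨-zeroʳ)
open import Data.Empty using (⊥; ⊥-elim)
open import Data.Fin using (Fin; zero; suc)
open import Data.Fin.Properties using (¬∀⟶∃¬)
open import Data.List using (List; []; _∷_; map; _++_)
open import Data.List.Properties using (map-++; map-∘; map-cong)
open import Data.List.Relation.Unary.All as All using (All)
open import Data.Nat using (ℕ; zero; suc; _+_; _*_; _^_; _≤_; _<_; _∸_; z≤n; s≤s; z<s; _≤?_; _≟_; >-nonZero)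
open import Data.Nat.ListAction using (sum)
open import Data.Nat.ListAction.Properties using (sum-++)
open import Data.Nat.Properties
open import Data.Nat.Induction using (<-rec)
open import Data.Nat.Tactic.RingSolver using (solve-∀)
open import Data.Product using (Σ; _×_; _,_; proj₁; proj₂)
open import Data.Sum using (_⊎_; inj₁; inj₂)
open import Data.Vec using ([]; _∷_; insertAt; removeAt; lookup)
open import Data.Vec.Properties using (removeAt-insertAt; insertAt-removeAt; ≡-dec)
open import Data.Vec.Relation.Binary.Pointwise.Inductive using (Pointwise-≡⇒≡; zipWith-comm; zipWith-assoc)
open import Relation.Nullary using (¬_; yes; no; does)
open import Relation.Nullary.Decidable using (dec-true)
open import Relation.Binary.PropositionalEquality

+-interchange : ∀ a b c d → (a + b) + (c + d) ≡ (a + c) + (b + d)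
+-interchange = interchange +-commutativeSemigroup

true≢false : true ≢ false
true≢false ()

∧-true : ∀ {a b : Bool} → a ∧ b ≡ true → a ≡ true × b ≡ true
∧-true {true} {true} _ = refl , refl

-- Vectors over F₂

⊕-comm : ∀ {n} (x y : V n) → x ⊕ y ≡ y ⊕ x
⊕-comm x y = Pointwise-≡⇒≡ (zipWith-comm xor-comm x y)

⊕-assoc : ∀ {n} (x y z : V n) → (x ⊕ y) ⊕ z ≡ x ⊕ (y ⊕ z)
⊕-assoc x y z = Pointwise-≡⇒≡ (zipWith-assoc xor-assoc x y z)

⊕-identityˡ : ∀ {n} (x : V n) → 0v ⊕ x ≡ x
⊕-identityˡ x = trans (⊕-comm 0v x) (⊕-0 x)

⊕-self : ∀ {n} (x : V n) → x ⊕ x ≡ 0v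
⊕-self [] = refl
⊕-self (a ∷ x) = cong₂ _∷_ (xor-same a) (⊕-self x)

⊕-cancelʳ : ∀ {n} (x y : V n) → (x ⊕ y) ⊕ y ≡ x
⊕-cancelʳ x y = begin
  (x ⊕ y) ⊕ y ≡⟨ ⊕-assoc x y y ⟩
  x ⊕ (y ⊕ y) ≡⟨ cong (x ⊕_) (⊕-self y) ⟩
  x ⊕ 0v      ≡⟨ ⊕-0 x ⟩
  x           ∎
  where open ≡-Reasoning

⊕-cancelˡ : ∀ {n} (x y : V n) → x ⊕ (x ⊕ y) ≡ y
⊕-cancelˡ x y = begin
  x ⊕ (x ⊕ y) ≡⟨ cong (x ⊕_) (⊕-comm x y) ⟩
  x ⊕ (y ⊕ x) ≡⟨ sym (⊕-assoc x y x) ⟩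
  (x ⊕ y) ⊕ x ≡⟨ cong (_⊕ x) (⊕-comm x y) ⟩
  (y ⊕ x) ⊕ x ≡⟨ ⊕-cancelʳ y x ⟩
  y           ∎
  where open ≡-Reasoning

⊕-interchange : ∀ {n} (a b c d : V n) → (a ⊕ b) ⊕ (c ⊕ d) ≡ (a ⊕ c) ⊕ (b ⊕ d)
⊕-interchange a b c d = begin
  (a ⊕ b) ⊕ (c ⊕ d) ≡⟨ ⊕-assoc a b (c ⊕ d) ⟩
  a ⊕ (b ⊕ (c ⊕ d)) ≡⟨ cong (a ⊕_) (sym (⊕-assoc b c d)) ⟩
  a ⊕ ((b ⊕ c) ⊕ d) ≡⟨ cong (λ z → a ⊕ (z ⊕ d)) (⊕-comm b c) ⟩
  a ⊕ ((c ⊕ b) ⊕ d) ≡⟨ cong (a ⊕_) (⊕-assoc c b d) ⟩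
  a ⊕ (c ⊕ (b ⊕ d)) ≡⟨ sym (⊕-assoc a c (b ⊕ d)) ⟩
  (a ⊕ c) ⊕ (b ⊕ d) ∎
  where open ≡-Reasoning

⊕-cancel-common : ∀ {n} (x v w : V n) → (x ⊕ v) ⊕ (x ⊕ w) ≡ v ⊕ w
⊕-cancel-common x v w = begin
  (x ⊕ v) ⊕ (x ⊕ w) ≡⟨ ⊕-interchange x v x w ⟩
  (x ⊕ x) ⊕ (v ⊕ w) ≡⟨ cong (_⊕ (v ⊕ w)) (⊕-self x) ⟩
  0v ⊕ (v ⊕ w)      ≡⟨ ⊕-identityˡ (v ⊕ w) ⟩
  v ⊕ w             ∎
  where open ≡-Reasoning

⊕≡0⇒≡ : ∀ {n} (x y : V n) → x ⊕ y ≡ 0v → x ≡ y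
⊕≡0⇒≡ x y p = begin
  x           ≡⟨ sym (⊕-cancelʳ x y) ⟩
  (x ⊕ y) ⊕ y ≡⟨ cong (_⊕ y) p ⟩
  0v ⊕ y      ≡⟨ ⊕-identityˡ y ⟩
  y           ∎
  where open ≡-Reasoning

isNonzero-0v : ∀ {n} (x : V n) → x ≡ 0v → isNonzero x ≡ false
isNonzero-0v {n} x refl = isNonzero-0 n

infix 25 _·_

_·_ : ∀ {n} → Bool → V n → V n
b · x = if b then x else 0v

·-distrib-xor : ∀ {n} (a b : Bool) (x : V n) → (a xor b) · x ≡ a · x ⊕ b · x
·-distrib-xor false false x = sym (⊕-self 0v)
·-distrib-xor false true  x = sym (⊕-identityˡ x)
·-distrib-xor true  false x = sym (⊕-0 x)
·-distrib-xor true  true  x = sym (⊕-self x)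

insertAt-⊕ : ∀ {n} (x y : V n) (i : Fin (suc n)) (a b : Bool) →
             insertAt (x ⊕ y) i (a xor b) ≡ insertAt x i a ⊕ insertAt y i b
insertAt-⊕ x y zero a b = refl
insertAt-⊕ (c ∷ x) (d ∷ y) (suc i) a b = cong ((c xor d) ∷_) (insertAt-⊕ x y i a b)

removeAt-⊕ : ∀ {n} (x y : V (suc n)) (i : Fin (suc n)) →
             removeAt (x ⊕ y) i ≡ removeAt x i ⊕ removeAt y i
removeAt-⊕ x y i = begin
  removeAt (x ⊕ y) i
    ≡⟨ cong (λ z → removeAt z i) (cong₂ _⊕_ (sym (insertAt-removeAt x i)) (sym (insertAt-removeAt y i))) ⟩
  removeAt (insertAt (removeAt x i) i (lookup x i) ⊕ insertAt (removeAt y i) i (lookup y i)) i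
    ≡⟨ cong (λ z → removeAt z i) (sym (insertAt-⊕ (removeAt x i) (removeAt y i) i _ _)) ⟩
  removeAt (insertAt (removeAt x i ⊕ removeAt y i) i _) i
    ≡⟨ removeAt-insertAt (removeAt x i ⊕ removeAt y i) i _ ⟩
  removeAt x i ⊕ removeAt y i ∎
  where open ≡-Reasoning

unit : ∀ {n} → Fin n → V n
unit zero = true ∷ 0v
unit (suc i) = false ∷ unit i

insertAt-0v-true : ∀ {n} (i : Fin (suc n)) → insertAt 0v i true ≡ unit i
insertAt-0v-true zero = refl
insertAt-0v-true {suc n} (suc i) = cong (false ∷_) (insertAt-0v-true i)

-- Sums over F₂ⁿ

∑ : ∀ {n} → (V n → ℕ) → ℕ
∑ {n} g = sum (map g (allVecs n))

𝟙 : ∀ {n} → (V n → Bool) → V n → ℕ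
𝟙 P x = if P x then 1 else 0

module _ {A : Set} where

  sum-map-+ : ∀ (g h : A → ℕ) xs → sum (map (λ x → g x + h x) xs) ≡ sum (map g xs) + sum (map h xs)
  sum-map-+ g h [] = refl
  sum-map-+ g h (x ∷ xs) = begin
    (g x + h x) + sum (map (λ x → g x + h x) xs)    ≡⟨ cong ((g x + h x) +_) (sum-map-+ g h xs) ⟩
    (g x + h x) + (sum (map g xs) + sum (map h xs)) ≡⟨ +-interchange (g x) (h x) _ _ ⟩
    (g x + sum (map g xs)) + (h x + sum (map h xs)) ∎
    where open ≡-Reasoning

  sum-map-mono : ∀ {g h : A → ℕ} → (∀ x → g x ≤ h x) → ∀ xs → sum (map g xs) ≤ sum (map h xs)
  sum-map-mono g≤h [] = z≤n
  sum-map-mono g≤h (x ∷ xs) = +-mono-≤ (g≤h x) (sum-map-mono g≤h xs)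

  sum-map-zero : ∀ (xs : List A) → sum (map (λ _ → 0) xs) ≡ 0
  sum-map-zero [] = refl
  sum-map-zero (x ∷ xs) = sum-map-zero xs

  sum-map-witness : ∀ (g : A → ℕ) xs → 0 < sum (map g xs) → Σ A λ x → 0 < g x
  sum-map-witness g (x ∷ xs) pos with g x in gx
  ... | suc _ = x , subst (0 <_) (sym gx) z<s
  ... | zero = sum-map-witness g xs pos

sum-map-swap : ∀ {A B : Set} (f : A → B → ℕ) xs ys →
  sum (map (λ x → sum (map (f x) ys)) xs) ≡ sum (map (λ y → sum (map (λ x → f x y) xs)) ys)
sum-map-swap f [] ys = sym (sum-map-zero ys)
sum-map-swap f (x ∷ xs) ys = begin
  sum (map (f x) ys) + sum (map (λ x → sum (map (f x) ys)) xs)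
    ≡⟨ cong (sum (map (f x) ys) +_) (sum-map-swap f xs ys) ⟩
  sum (map (f x) ys) + sum (map (λ y → sum (map (λ x → f x y) xs)) ys)
    ≡⟨ sym (sum-map-+ (f x) (λ y → sum (map (λ x → f x y) xs)) ys) ⟩
  sum (map (λ y → f x y + sum (map (λ x → f x y) xs)) ys) ∎
  where open ≡-Reasoning

∑-cong : ∀ {n} {g h : V n → ℕ} → (∀ x → g x ≡ h x) → ∑ g ≡ ∑ h
∑-cong {n} g≗h = cong sum (map-cong g≗h (allVecs n))

∑-mono : ∀ {n} {g h : V n → ℕ} → (∀ x → g x ≤ h x) → ∑ g ≤ ∑ h
∑-mono {n} g≤h = sum-map-mono g≤h (allVecs n)

∑-+ : ∀ {n} (g h : V n → ℕ) → ∑ (λ x → g x + h x) ≡ ∑ g + ∑ h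
∑-+ {n} g h = sum-map-+ g h (allVecs n)

∑-swap : ∀ {n s} (f : V n → V s → ℕ) → ∑ (λ x → ∑ (f x)) ≡ ∑ (λ u → ∑ (λ x → f x u))
∑-swap {n} {s} f = sum-map-swap f (allVecs n) (allVecs s)

∑-split : ∀ {n} (g : V (suc n) → ℕ) → ∑ g ≡ ∑ (λ x → g (false ∷ x)) + ∑ (λ x → g (true ∷ x))
∑-split {n} g = begin
  sum (map g (map (false ∷_) A ++ map (true ∷_) A))
    ≡⟨ cong sum (map-++ g (map (false ∷_) A) (map (true ∷_) A)) ⟩
  sum (map g (map (false ∷_) A) ++ map g (map (true ∷_) A))
    ≡⟨ sum-++ (map g (map (false ∷_) A)) (map g (map (true ∷_) A)) ⟩
  sum (map g (map (false ∷_) A)) + sum (map g (map (true ∷_) A))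
    ≡⟨ cong₂ _+_ (cong sum (sym (map-∘ A))) (cong sum (sym (map-∘ A))) ⟩
  ∑ (λ x → g (false ∷ x)) + ∑ (λ x → g (true ∷ x)) ∎
  where
  A = allVecs n
  open ≡-Reasoning

∑-const : ∀ {n} (c : ℕ) → ∑ {n} (λ _ → c) ≡ 2 ^ n * c
∑-const {zero} c = refl
∑-const {suc n} c = begin
  ∑ {suc n} (λ _ → c)               ≡⟨ ∑-split {n} (λ _ → c) ⟩
  ∑ {n} (λ _ → c) + ∑ {n} (λ _ → c) ≡⟨ cong₂ _+_ (∑-const {n} c) (∑-const {n} c) ⟩
  2 ^ n * c + 2 ^ n * c             ≡⟨ double (2 ^ n) c ⟩
  2 * 2 ^ n * c                     ∎
  where
  open ≡-Reasoning
  double : ∀ p c → p * c + p * c ≡ 2 * p * c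
  double = solve-∀

≤∑ : ∀ {n} (g : V n → ℕ) (x : V n) → g x ≤ ∑ g
≤∑ g [] = m≤m+n (g []) 0
≤∑ g (false ∷ x) = ≤-trans (≤∑ (λ y → g (false ∷ y)) x) (≤-trans (m≤m+n _ _) (≤-reflexive (sym (∑-split g))))
≤∑ g (true ∷ x) = ≤-trans (≤∑ (λ y → g (true ∷ y)) x) (≤-trans (m≤n+m _ _) (≤-reflexive (sym (∑-split g))))

∑-translate : ∀ {n} (g : V n → ℕ) (v : V n) → ∑ (λ x → g (x ⊕ v)) ≡ ∑ g
∑-translate g [] = refl
∑-translate g (false ∷ v) = begin
  ∑ (λ x → g (x ⊕ (false ∷ v)))
    ≡⟨ ∑-split (λ x → g (x ⊕ (false ∷ v))) ⟩
  ∑ (λ x → g (false ∷ (x ⊕ v))) + ∑ (λ x → g (true ∷ (x ⊕ v)))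
    ≡⟨ cong₂ _+_ (∑-translate (λ y → g (false ∷ y)) v) (∑-translate (λ y → g (true ∷ y)) v) ⟩
  ∑ (λ x → g (false ∷ x)) + ∑ (λ x → g (true ∷ x))
    ≡⟨ sym (∑-split g) ⟩
  ∑ g ∎
  where open ≡-Reasoning
∑-translate g (true ∷ v) = begin
  ∑ (λ x → g (x ⊕ (true ∷ v)))
    ≡⟨ ∑-split (λ x → g (x ⊕ (true ∷ v))) ⟩
  ∑ (λ x → g (true ∷ (x ⊕ v))) + ∑ (λ x → g (false ∷ (x ⊕ v)))
    ≡⟨ cong₂ _+_ (∑-translate (λ y → g (true ∷ y)) v) (∑-translate (λ y → g (false ∷ y)) v) ⟩
  ∑ (λ x → g (true ∷ x)) + ∑ (λ x → g (false ∷ x))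
    ≡⟨ +-comm (∑ (λ x → g (true ∷ x))) _ ⟩
  ∑ (λ x → g (false ∷ x)) + ∑ (λ x → g (true ∷ x))
    ≡⟨ sym (∑-split g) ⟩
  ∑ g ∎
  where open ≡-Reasoning

∑-insertAt : ∀ {n} (i : Fin (suc n)) (g : V (suc n) → ℕ) →
             ∑ g ≡ ∑ (λ u → g (insertAt u i false)) + ∑ (λ u → g (insertAt u i true))
∑-insertAt zero g = ∑-split g
∑-insertAt {suc n} (suc i) g = begin
  ∑ g
    ≡⟨ ∑-split g ⟩
  ∑ (λ x → g (false ∷ x)) + ∑ (λ x → g (true ∷ x))
    ≡⟨ cong₂ _+_ (∑-insertAt i (λ x → g (false ∷ x))) (∑-insertAt i (λ x → g (true ∷ x))) ⟩
  (a + b) + (c + d)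
    ≡⟨ +-interchange a b c d ⟩
  (a + c) + (b + d)
    ≡⟨ sym (cong₂ _+_ (∑-split (λ u → g (insertAt u (suc i) false))) (∑-split (λ u → g (insertAt u (suc i) true)))) ⟩
  ∑ (λ u → g (insertAt u (suc i) false)) + ∑ (λ u → g (insertAt u (suc i) true)) ∎
  where
  open ≡-Reasoning
  a = ∑ (λ x → g (false ∷ insertAt x i false)); b = ∑ (λ x → g (false ∷ insertAt x i true))
  c = ∑ (λ x → g (true ∷ insertAt x i false));  d = ∑ (λ x → g (true ∷ insertAt x i true))

-- Counting

count-cong : ∀ {n} {P Q : V n → Bool} → (∀ x → P x ≡ Q x) → count P ≡ count Q
count-cong P≗Q = ∑-cong (λ x → cong (λ b → if b then 1 else 0) (P≗Q x))

count-mono : ∀ {n} {P Q : V n → Bool} → (∀ x → P x ≡ true → Q x ≡ true) → count P ≤ count Q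
count-mono {P = P} {Q} P⊆Q = ∑-mono pointwise
  where
  pointwise : ∀ x → 𝟙 P x ≤ 𝟙 Q x
  pointwise x with P x in px
  ... | false = z≤n
  ... | true rewrite P⊆Q x px = ≤-refl

count-complement : ∀ {n} (P : V n → Bool) → count P + count (λ x → not (P x)) ≡ 2 ^ n
count-complement {n} P = begin
  count P + count (λ x → not (P x))    ≡⟨ sym (∑-+ (𝟙 P) (𝟙 (λ x → not (P x)))) ⟩
  ∑ (λ x → 𝟙 P x + 𝟙 (λ x → not (P x)) x) ≡⟨ ∑-cong pointwise ⟩
  ∑ {n} (λ _ → 1)                      ≡⟨ ∑-const {n} 1 ⟩
  2 ^ n * 1                            ≡⟨ *-identityʳ _ ⟩
  2 ^ n                                ∎
  where
  open ≡-Reasoning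
  pointwise : ∀ x → 𝟙 P x + 𝟙 (λ x → not (P x)) x ≡ 1
  pointwise x with P x
  ... | true = refl
  ... | false = refl

count-∨ : ∀ {n} (P Q : V n → Bool) → count (λ x → P x ∨ Q x) ≤ count P + count Q
count-∨ P Q = ≤-trans (∑-mono pointwise) (≤-reflexive (∑-+ (𝟙 P) (𝟙 Q)))
  where
  pointwise : ∀ x → 𝟙 (λ x → P x ∨ Q x) x ≤ 𝟙 P x + 𝟙 Q x
  pointwise x with P x | Q x
  ... | true  | _     = s≤s z≤n
  ... | false | true  = s≤s z≤n
  ... | false | false = z≤n

1≤count : ∀ {n} (P : V n → Bool) (x : V n) → P x ≡ true → 1 ≤ count P
1≤count P x px = ≤-trans (≤-reflexive (cong (λ b → if b then 1 else 0) (sym px))) (≤∑ (𝟙 P) x)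

count≡0 : ∀ {n} (P : V n → Bool) → count P ≡ 0 → ∀ x → P x ≡ false
count≡0 P none x with P x in px
... | false = refl
... | true = ⊥-elim (<-irrefl refl (≤-trans (1≤count P x px) (≤-reflexive none)))

count-witness : ∀ {n} (P : V n → Bool) → 1 ≤ count P → Σ (V n) λ x → P x ≡ true
count-witness {n} P pos = let x , px = sum-map-witness (𝟙 P) (allVecs n) pos in x , 𝟙-pos x px
  where
  𝟙-pos : ∀ x → 0 < 𝟙 P x → P x ≡ true
  𝟙-pos x p with P x
  ... | true = refl
  ... | false = ⊥-elim (<-irrefl refl p)

count<⇒witness : ∀ {n} (P : V n → Bool) → count P < 2 ^ n → Σ (V n) λ x → P x ≡ false
count<⇒witness P lt = let x , px = count-witness (λ x → not (P x)) pos in x , not-injective px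
  where
  pos : 1 ≤ count (λ x → not (P x))
  pos = +-cancelˡ-< (count P) 0 _ (subst₂ _<_ (sym (+-identityʳ _)) (sym (count-complement P)) lt)

-- Subspaces and hyperplanes

linear-0 : ∀ {m n} {f : V m → V n} → IsLinear f → f 0v ≡ 0v
linear-0 {f = f} f-lin = begin
  f 0v          ≡⟨ cong f (sym (⊕-self 0v)) ⟩
  f (0v ⊕ 0v)   ≡⟨ f-lin 0v 0v ⟩
  f 0v ⊕ f 0v   ≡⟨ ⊕-self (f 0v) ⟩
  0v            ∎
  where open ≡-Reasoning

module _ {n} {H : V n → Bool} (H-sub : IsSubspace H) where
  open IsSubspace H-sub

  subspace-shift : ∀ x h → H h ≡ true → H (x ⊕ h) ≡ H x
  subspace-shift x h hh with H x in hx | H (x ⊕ h) in hxh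
  ... | true  | _     = trans (sym hxh) (closed x h hx hh)
  ... | false | false = refl
  ... | false | true  = trans (sym (subst (λ w → H w ≡ true) (⊕-cancelʳ x h) (closed _ _ hxh hh))) hx

  -- H, H ⊕ v and H ⊕ w would be disjoint, of total size 3|H| > 2|H| = 2ⁿ.
  outside-sum∈hyperplane : HasCodim H 1 → ∀ v w → H v ≡ false → H w ≡ false → H (v ⊕ w) ≡ true
  outside-sum∈hyperplane codim v w hv hw with H (v ⊕ w) in hvw
  ... | true = refl
  ... | false = ⊥-elim (<-irrefl refl (subst (1 ≤_) |H|≡0 (1≤count H 0v has0)))
    where
    not-both : ∀ {a b c} → H a ≡ true → H b ≡ true → H c ≡ false → a ⊕ b ≡ c → ⊥
    not-both ha hb hc ab≡c = true≢false (trans (sym (subst (λ z → H z ≡ true) ab≡c (closed _ _ ha hb))) hc)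
    cosets : ∀ x → 𝟙 H x + 𝟙 H (x ⊕ v) + 𝟙 H (x ⊕ w) ≤ 1
    cosets x with H x in h₀ | H (x ⊕ v) in h₁ | H (x ⊕ w) in h₂
    ... | false | false | false = z≤n
    ... | true  | false | false = ≤-refl
    ... | false | true  | false = ≤-refl
    ... | false | false | true  = ≤-refl
    ... | true  | true  | _     = ⊥-elim (not-both h₀ h₁ hv (⊕-cancelˡ x v))
    ... | true  | false | true  = ⊥-elim (not-both h₀ h₂ hw (⊕-cancelˡ x w))
    ... | false | true  | true  = ⊥-elim (not-both h₁ h₂ hvw (⊕-cancel-common x v w))
    three-cosets : count H + count H + count H ≤ 2 ^ n
    three-cosets = begin
      count H + count H + count H
        ≡⟨ sym (cong₂ (λ a b → count H + a + b) (∑-translate (𝟙 H) v) (∑-translate (𝟙 H) w)) ⟩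
      ∑ (𝟙 H) + ∑ (λ x → 𝟙 H (x ⊕ v)) + ∑ (λ x → 𝟙 H (x ⊕ w))
        ≡⟨ sym (trans (∑-+ (λ x → 𝟙 H x + 𝟙 H (x ⊕ v)) (λ x → 𝟙 H (x ⊕ w))) (cong (_+ _) (∑-+ (𝟙 H) (λ x → 𝟙 H (x ⊕ v))))) ⟩
      ∑ (λ x → 𝟙 H x + 𝟙 H (x ⊕ v) + 𝟙 H (x ⊕ w))
        ≤⟨ ∑-mono cosets ⟩
      ∑ {n} (λ _ → 1)
        ≡⟨ trans (∑-const {n} 1) (*-identityʳ _) ⟩
      2 ^ n ∎
      where open ≤-Reasoning
    |H|≡0 : count H ≡ 0
    |H|≡0 = n≤0⇒n≡0 (+-cancelˡ-≤ (count H + count H) (count H) 0 (begin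
      count H + count H + count H ≤⟨ three-cosets ⟩
      2 ^ n                       ≡⟨ sym codim ⟩
      count H * 2                 ≡⟨ double (count H) ⟩
      count H + count H + 0       ∎))
      where
      open ≤-Reasoning
      double : ∀ c → c * 2 ≡ c + c + 0
      double = solve-∀

units⊆subspace : ∀ {n} {H : V n → Bool} → IsSubspace H → (∀ i → H (unit i) ≡ true) → ∀ z → H z ≡ true
units⊆subspace H-sub units [] = IsSubspace.has0 H-sub
units⊆subspace {H = H} H-sub units (b ∷ z) =
  subst (λ w → H w ≡ true) (decompose b)
        (IsSubspace.closed H-sub _ _ (scaled b) (units⊆subspace tail-sub (λ i → units (suc i)) z))
  where
  tail-sub : IsSubspace (λ y → H (false ∷ y))
  tail-sub = record { has0 = IsSubspace.has0 H-sub
                    ; closed = λ x y → IsSubspace.closed H-sub (false ∷ x) (false ∷ y) }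
  scaled : ∀ b → H (b · unit zero) ≡ true
  scaled false = IsSubspace.has0 H-sub
  scaled true = units zero
  decompose : ∀ b → b · unit zero ⊕ (false ∷ z) ≡ b ∷ z
  decompose false = cong (false ∷_) (⊕-identityˡ z)
  decompose true = cong (true ∷_) (⊕-identityˡ z)

unit-outside : ∀ {n} {H : V n → Bool} → IsSubspace H → ∀ z → H z ≡ false → Σ (Fin n) λ i → H (unit i) ≡ false
unit-outside {n} {H} H-sub z hz =
  let i , ¬hi = ¬∀⟶∃¬ n (λ i → H (unit i) ≡ true) (λ i → H (unit i) Bool.≟ true)
                      (λ units → true≢false (trans (sym (units⊆subspace H-sub units z)) hz))
  in i , ¬-not ¬hi

hyperplane-misses-unit : ∀ {m} {H : V (suc m) → Bool} → IsHyperplane H → Σ (Fin (suc m)) λ i → H (unit i) ≡ false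
hyperplane-misses-unit {m} {H} (H-sub , codim) =
  let z , hz = count<⇒witness H |H|<2ᵐ⁺¹ in unit-outside H-sub z hz
  where
  |H|<2ᵐ⁺¹ : count H < 2 ^ suc m
  |H|<2ᵐ⁺¹ = begin-strict
    count H     <⟨ m<m*n (count H) 2 ⦃ >-nonZero (1≤count H 0v (IsSubspace.has0 H-sub)) ⦄ ≤-refl ⟩
    count H * 2 ≡⟨ codim ⟩
    2 ^ suc m   ∎
    where open ≤-Reasoning

-- A hyperplane H of F₂^{m+1} with unit i ∉ H is the graph of a linear map over
-- the coordinate hyperplane obtained by deleting coordinate i.
module HyperplaneChart {m} {H : V (suc m) → Bool} (H-hyp : IsHyperplane H)
                       (i : Fin (suc m)) (unit-i∉H : H (unit i) ≡ false) where
  open IsSubspace (proj₁ H-hyp)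

  |H| : count H ≡ 2 ^ m
  |H| = *-cancelʳ-≡ (count H) (2 ^ m) 2 (trans (proj₂ H-hyp) (*-comm 2 (2 ^ m)))

  fiber-bit-unique : ∀ w a b → H (insertAt w i a) ≡ true → H (insertAt w i b) ≡ true → a ≡ b
  fiber-bit-unique w false false _ _ = refl
  fiber-bit-unique w true  true  _ _ = refl
  fiber-bit-unique w true  false ha hb = sym (fiber-bit-unique w false true hb ha)
  fiber-bit-unique w false true  ha hb =
    ⊥-elim (true≢false (trans (sym (subst (λ x → H x ≡ true) difference (closed _ _ ha hb))) unit-i∉H))
    where
    difference : insertAt w i false ⊕ insertAt w i true ≡ unit i
    difference = begin
      insertAt w i false ⊕ insertAt w i true ≡⟨ sym (insertAt-⊕ w w i false true) ⟩
      insertAt (w ⊕ w) i true                 ≡⟨ cong (λ y → insertAt y i true) (⊕-self w) ⟩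
      insertAt 0v i true                      ≡⟨ insertAt-0v-true i ⟩
      unit i                                  ∎
      where open ≡-Reasoning

  j : V m → V (suc m)
  j u = insertAt u i (not (H (insertAt u i false)))

  j∈H : ∀ u → H (j u) ≡ true
  j∈H u with H (insertAt u i false) in h
  ... | true = h
  ... | false = subst (λ x → H x ≡ true) flip (outside-sum∈hyperplane (proj₁ H-hyp) (proj₂ H-hyp) _ _ h unit-i∉H)
    where
    flip : insertAt u i false ⊕ unit i ≡ insertAt u i true
    flip = begin
      insertAt u i false ⊕ unit i            ≡⟨ cong (insertAt u i false ⊕_) (sym (insertAt-0v-true i)) ⟩
      insertAt u i false ⊕ insertAt 0v i true ≡⟨ sym (insertAt-⊕ u 0v i false true) ⟩
      insertAt (u ⊕ 0v) i true               ≡⟨ cong (λ y → insertAt y i true) (⊕-0 u) ⟩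
      insertAt u i true                      ∎
      where open ≡-Reasoning

  fiber-unique : ∀ w b → H (insertAt w i b) ≡ true → insertAt w i b ≡ j w
  fiber-unique w b hb = cong (insertAt w i) (fiber-bit-unique w b _ hb (j∈H w))

  j-linear : IsLinear j
  j-linear u u' = trans
    (sym (fiber-unique (u ⊕ u') _ (subst (λ x → H x ≡ true) (sym (insertAt-⊕ u u' i _ _)) (closed _ _ (j∈H u) (j∈H u')))))
    (insertAt-⊕ u u' i _ _)

  |∁H| : count (λ x → not (H x)) ≡ 2 ^ m
  |∁H| = +-cancelˡ-≡ (2 ^ m) _ _ (begin
    2 ^ m + count (λ x → not (H x))   ≡⟨ cong (_+ count (λ x → not (H x))) (sym |H|) ⟩
    count H + count (λ x → not (H x)) ≡⟨ count-complement H ⟩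
    2 ^ suc m                         ≡⟨ cong (2 ^ m +_) (+-identityʳ (2 ^ m)) ⟩
    2 ^ m + 2 ^ m                     ∎)
    where open ≡-Reasoning

  π : V (suc m) → V m
  π x = removeAt x i

  π-linear : IsLinear π
  π-linear x y = removeAt-⊕ x y i

  π∘j : ∀ u → π (j u) ≡ u
  π∘j u = removeAt-insertAt u i _

  j∘π : ∀ x → H x ≡ true → j (π x) ≡ x
  j∘π x hx = trans
    (sym (fiber-unique (π x) (lookup x i) (subst (λ y → H y ≡ true) (sym (insertAt-removeAt x i)) hx)))
    (insertAt-removeAt x i)

  count-∘j : (P : V (suc m) → Bool) → count (λ u → P (j u)) ≡ count (λ x → H x ∧ P x)
  count-∘j P = sym (trans (∑-insertAt i (𝟙 (λ x → H x ∧ P x))) (trans (sym (∑-+ {m} _ _)) (∑-cong one-in-fiber)))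
    where
    one-in-fiber : ∀ u → 𝟙 (λ x → H x ∧ P x) (insertAt u i false) + 𝟙 (λ x → H x ∧ P x) (insertAt u i true)
                         ≡ 𝟙 (λ u → P (j u)) u
    one-in-fiber u with H (insertAt u i false) in h₀ | H (insertAt u i true) in h₁
    ... | true  | true  = ⊥-elim (true≢false (sym (fiber-bit-unique u false true h₀ h₁)))
    ... | true  | false = +-identityʳ _
    ... | false | true  = refl
    ... | false | false = ⊥-elim (true≢false (trans (sym (j∈H u)) (trans (cong (λ b → H (insertAt u i (not b))) h₀) h₁)))

-- Copies of projective geometries

-- Injectivity is left out: it follows from linearity once 0 ∉ E (containsPG⇒contains).
ContainsPG : ∀ {n} → (V n → Bool) → ℕ → Set
ContainsPG {n} E s = Σ (V s → V n) λ ι → IsLinear ι × (∀ u → isNonzero u ≡ true → E (ι u) ≡ true)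

containsPG⇒contains : ∀ {s} (M : Matroid) → ContainsPG (E M) s → Contains M (PG s)
containsPG⇒contains M (ι , ι-lin , ι-E) = ι , ι-lin , injective , ι-E
  where
  injective : Injective ι
  injective x y ιx≡ιy with isNonzero (x ⊕ y) in nz
  ... | false = ⊕≡0⇒≡ x y (isNonzero-false (x ⊕ y) nz)
  ... | true = ⊥-elim (true≢false (trans (sym (ι-E (x ⊕ y) nz)) (trans (cong (E M) ι[x⊕y]≡0v) (zero∉E M))))
    where
    ι[x⊕y]≡0v : ι (x ⊕ y) ≡ 0v
    ι[x⊕y]≡0v = trans (ι-lin x y) (trans (cong (ι x ⊕_) (sym ιx≡ιy)) (⊕-self (ι x)))

containsPG-suc : ∀ {n s} {E : V n → Bool} (c : ContainsPG E s) (x : V n) →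
                 (∀ u → E (x ⊕ proj₁ c u) ≡ true) → ContainsPG E (suc s)
containsPG-suc {n} {s} {E} (ι , ι-lin , ι-E) x coset⊆E = ι⁺ , ι⁺-lin , ι⁺-E
  where
  ι⁺ : V (suc s) → V n
  ι⁺ (b ∷ u) = b · x ⊕ ι u
  ι⁺-lin : IsLinear ι⁺
  ι⁺-lin (a ∷ u) (b ∷ u') =
    trans (cong₂ _⊕_ (·-distrib-xor a b x) (ι-lin u u')) (⊕-interchange (a · x) (b · x) (ι u) (ι u'))
  ι⁺-E : ∀ v → isNonzero v ≡ true → E (ι⁺ v) ≡ true
  ι⁺-E (true ∷ u) _ = coset⊆E u
  ι⁺-E (false ∷ u) nz = subst (λ w → E w ≡ true) (sym (⊕-identityˡ (ι u))) (ι-E u nz)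

coset-meets-complement : ∀ {n s} {E : V n → Bool} → ¬ ContainsPG E (suc s) → (c : ContainsPG E s) →
                         ∀ x → 1 ≤ count (λ u → not (E (x ⊕ proj₁ c u)))
coset-meets-complement {E = E} noPG c x =
  n≢0⇒n>0 λ none → noPG (containsPG-suc {E = E} c x (λ u → not-injective (count≡0 (λ u → not (E (x ⊕ proj₁ c u))) none u)))

-- Count the pairs (x, u) with x ∉ H and x ⊕ ι u ∉ E: every x ∉ H lies in at least
-- one of them, and every u in exactly |Y ∖ H|, since ι u ∈ H.
outside-≤-cosets : ∀ {n s} {E H : V n → Bool} → IsSubspace H → ¬ ContainsPG E (suc s) →
                   (c : ContainsPG E s) → (∀ u → H (proj₁ c u) ≡ true) →
                   count (λ x → not (H x)) ≤ 2 ^ s * count (λ x → not (E x) ∧ not (H x))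
outside-≤-cosets {n} {s} {E} {H} H-sub noPG c ι⊆H = begin
  count (λ x → not (H x))      ≤⟨ ∑-mono each-x ⟩
  ∑ (λ x → ∑ (pairs x))        ≡⟨ ∑-swap pairs ⟩
  ∑ (λ u → ∑ (λ x → pairs x u)) ≡⟨ ∑-cong each-u ⟩
  ∑ {s} (λ _ → |Y∖H|)          ≡⟨ ∑-const {s} |Y∖H| ⟩
  2 ^ s * |Y∖H|                ∎
  where
  open ≤-Reasoning
  ι = proj₁ c
  |Y∖H| = count (λ x → not (E x) ∧ not (H x))
  pairs : V n → V s → ℕ
  pairs x u = 𝟙 (λ y → not (E (y ⊕ ι u)) ∧ not (H y)) x
  each-x : ∀ x → 𝟙 (λ y → not (H y)) x ≤ ∑ (pairs x)
  each-x x with H x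
  ... | true = z≤n
  ... | false = begin
    1                                      ≤⟨ coset-meets-complement {E = E} noPG c x ⟩
    count (λ u → not (E (x ⊕ ι u)))        ≡⟨ count-cong (λ u → sym (∧-identityʳ (not (E (x ⊕ ι u))))) ⟩
    count (λ u → not (E (x ⊕ ι u)) ∧ true) ∎
  each-u : ∀ u → ∑ (λ x → pairs x u) ≡ |Y∖H|
  each-u u = trans (count-cong λ y → cong (λ b → not (E (y ⊕ ι u)) ∧ not b) (sym (subspace-shift H-sub y (ι u) (ι⊆H u))))
                   (∑-translate (𝟙 (λ x → not (E x) ∧ not (H x))) (ι u))

-- Avoiding subspaces and the critical number

Avoids : ∀ {n} → (V n → Bool) → ℕ → Set
Avoids {n} E k = Σ (V n → Bool) λ S → IsSubspace S × HasCodim S k × Disjoint S E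

zero-subspace-avoids : ∀ {n} {E : V n → Bool} → E 0v ≡ false → Avoids E n
zero-subspace-avoids {n} {E} 0∉E = Z , Z-sub , Z-codim , Z∩E=∅
  where
  Z : ∀ {m} → V m → Bool
  Z x = not (isNonzero x)
  Z⇒≡0v : ∀ (x : V n) → Z x ≡ true → x ≡ 0v
  Z⇒≡0v x p = isNonzero-false x (not-injective p)
  Z-sub : IsSubspace (Z {n})
  Z-sub = record
    { has0 = cong not (isNonzero-0 n)
    ; closed = λ x y zx zy → cong not (isNonzero-0v (x ⊕ y)
                 (trans (cong₂ _⊕_ (Z⇒≡0v x zx) (Z⇒≡0v y zy)) (⊕-self 0v))) }
  |Z| : ∀ m → count (Z {m}) ≡ 1
  |Z| zero = refl
  |Z| (suc m) = trans (∑-split (𝟙 (Z {suc m}))) (cong₂ _+_ (|Z| m) (trans (∑-const {m} 0) (*-zeroʳ (2 ^ m))))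
  Z-codim : count (Z {n}) * 2 ^ n ≡ 2 ^ n
  Z-codim = trans (cong (_* 2 ^ n) (|Z| n)) (*-identityˡ _)
  Z∩E=∅ : Disjoint (Z {n}) E
  Z∩E=∅ x zx = subst (λ w → E w ≡ false) (sym (Z⇒≡0v x zx)) 0∉E

¬-least : ∀ {A : ℕ → Set} → (∀ k → A k → (∀ j → j < k → ¬ A j) → ⊥) → ∀ k → ¬ A k
¬-least {A} least⇒⊥ = <-rec (λ k → ¬ A k) (λ k below a → least⇒⊥ k a (λ j j<k → below j<k))

critical-number-exists : (M : Matroid) → ¬ (∀ k → ¬ IsCriticalNumber M k)
critical-number-exists M none =
  ¬-least (λ k avoids least → none k (avoids , least)) (r M) (zero-subspace-avoids (zero∉E M))

unavoidable-below-critical : (M : Matroid) (t : ℕ) → (∀ k → IsCriticalNumber M k → t < k) →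
                             ∀ j → j ≤ t → ¬ AvoidableAt M j
unavoidable-below-critical M t χ>t j j≤t avoidsⱼ =
  ¬-least (λ k avoidsₖ least → least j (≤-<-trans j≤t (χ>t k (avoidsₖ , least))) avoidsⱼ) j avoidsⱼ

-- Sum-free sets

SumFree : ∀ {m} → (V m → Bool) → Set
SumFree S = S 0v ≡ false × (∀ a b → S a ≡ true → S b ≡ true → S (a ⊕ b) ≡ false)

sumFree⇒¬PG2 : ∀ {m} {S : V m → Bool} → SumFree S → ¬ ContainsPG S 2
sumFree⇒¬PG2 {S = S} (_ , a+b∉S) (ι , ι-lin , ι-S) = true≢false (begin
  true                                             ≡⟨ sym (ι-S (true ∷ true ∷ []) refl) ⟩
  S (ι (true ∷ true ∷ []))                         ≡⟨ cong S (ι-lin (true ∷ false ∷ []) (false ∷ true ∷ [])) ⟩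
  S (ι (true ∷ false ∷ []) ⊕ ι (false ∷ true ∷ [])) ≡⟨ a+b∉S _ _ (ι-S (true ∷ false ∷ []) refl) (ι-S (false ∷ true ∷ []) refl) ⟩
  false                                            ∎)
  where open ≡-Reasoning

-- A triangle {a, b, a ⊕ b} is the coset b ⊕ {0, a} over the point {a}.
¬PG2⇒sumFree : ∀ {m} {S : V m → Bool} → S 0v ≡ false → ¬ ContainsPG S 2 → SumFree S
¬PG2⇒sumFree {m} {S} 0∉S noPG = 0∉S , no-triangle
  where
  no-triangle : ∀ a b → S a ≡ true → S b ≡ true → S (a ⊕ b) ≡ false
  no-triangle a b sa sb = ¬-not λ sab → noPG (containsPG-suc {E = S} point b (coset sab))
    where
    point : ContainsPG S 1
    point = (λ { (c ∷ []) → c · a })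
          , (λ { (c ∷ []) (d ∷ []) → ·-distrib-xor c d a })
          , (λ { (true ∷ []) _ → sa })
    coset : S (a ⊕ b) ≡ true → ∀ u → S (b ⊕ proj₁ point u) ≡ true
    coset _   (false ∷ []) = subst (λ w → S w ≡ true) (sym (⊕-0 b)) sb
    coset sab (true ∷ [])  = subst (λ w → S w ≡ true) (⊕-comm a b) sab

sum-of-pair : ∀ {m} (S : V m → Bool) {a v : V m} → S a ≡ true → S (a ⊕ v) ≡ true →
              Σ (List (V m)) λ xs → All (λ x → S x ≡ true) xs × vsum xs ≡ v
sum-of-pair S {a} {v} sa sav =
  a ∷ (a ⊕ v) ∷ [] , sa All.∷ sav All.∷ All.[] , trans (cong (a ⊕_) (⊕-0 (a ⊕ v))) (⊕-cancelˡ a v)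

-- The complement of S and its translate by v cannot cover F₂ᵐ, so some a has a, a ⊕ v ∈ S.
co-small⇒spans : ∀ {m} (S : V m → Bool) → 2 * count (λ x → not (S x)) < 2 ^ m → Spans S
co-small⇒spans {m} S small v =
  let a , pa = count<⇒witness bad (≤-<-trans (count-∨ (λ a → not (S a)) (λ a → not (S (a ⊕ v)))) bound)
      sa , sav = both pa
  in sum-of-pair S sa sav
  where
  bad : V m → Bool
  bad a = not (S a) ∨ not (S (a ⊕ v))
  both : ∀ {b c} → not b ∨ not c ≡ false → b ≡ true × c ≡ true
  both {true} {true} _ = refl , refl
  y = count (λ x → not (S x))
  bound : y + count (λ a → not (S (a ⊕ v))) < 2 ^ m
  bound = subst (λ z → y + z < 2 ^ m) (sym (∑-translate (𝟙 (λ x → not (S x))) v))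
                (subst (_< 2 ^ m) (cong (y +_) (+-identityʳ y)) small)

module SumFreeExtension {m : ℕ} where

  private
    _≟ᵥ_ = ≡-dec {n = m} Bool._≟_

  addable : (V m → Bool) → V m → Bool
  addable S v = isNonzero v ∧ not (S v) ∧ does (count (λ a → S a ∧ S (a ⊕ v)) ≟ 0)

  insert : V m → (V m → Bool) → V m → Bool
  insert v S x = does (x ≟ᵥ v) ∨ S x

  ⊆insert : ∀ S v x → S x ≡ true → insert v S x ≡ true
  ⊆insert S v x sx = trans (cong (does (x ≟ᵥ v) ∨_) sx) (∨-zeroʳ _)

  saturated⇒spans : (S : V m → Bool) → count (addable S) ≡ 0 → Spans S
  saturated⇒spans S saturated v with S v in sv | isNonzero v in nv
  ... | true  | _     = v ∷ [] , sv All.∷ All.[] , ⊕-0 v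
  ... | false | false = [] , All.[] , sym (isNonzero-false v nv)
  ... | false | true  with count (λ a → S a ∧ S (a ⊕ v)) ≟ 0
  ...   | yes none = ⊥-elim (true≢false (trans (sym addable-v) (count≡0 (addable S) saturated v)))
    where
    addable-v : addable S v ≡ true
    addable-v = cong₂ _∧_ nv (cong₂ (λ b c → not b ∧ c) sv (cong (λ c → does (c ≟ 0)) none))
  ...   | no some = let a , pa = count-witness (λ a → S a ∧ S (a ⊕ v)) (n≢0⇒n>0 some)
                        sa , sav = ∧-true pa
                    in sum-of-pair S sa sav

  module _ (S : V m → Bool) (v : V m) (v-addable : addable S v ≡ true) where

    private
      ≟0-true : ∀ {c} → does (c ≟ 0) ≡ true → c ≡ 0
      ≟0-true {zero} _ = refl

      conditions = ∧-true {isNonzero v} v-addable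
      conditions′ = ∧-true {not (S v)} (proj₂ conditions)

      v≢0v : v ≢ 0v
      v≢0v v≡0v = true≢false (trans (sym (proj₁ conditions)) (isNonzero-0v v v≡0v))

      v∉S : S v ≡ false
      v∉S = not-injective (proj₁ conditions′)

      no-pair : ∀ a → S a ≡ true → S (a ⊕ v) ≡ false
      no-pair a sa = subst (λ b → b ∧ S (a ⊕ v) ≡ false) sa
        (count≡0 (λ a → S a ∧ S (a ⊕ v)) (≟0-true (proj₂ conditions′)) a)

      insert-split : ∀ x → insert v S x ≡ true → x ≡ v ⊎ S x ≡ true
      insert-split x p with x ≟ᵥ v
      ... | yes x≡v = inj₁ x≡v
      ... | no _ = inj₂ p

      insert-false : ∀ x → x ≢ v → S x ≡ false → insert v S x ≡ false
      insert-false x x≢v sx with x ≟ᵥ v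
      ... | yes x≡v = ⊥-elim (x≢v x≡v)
      ... | no _ = sx

    insert-sumFree : SumFree S → SumFree (insert v S)
    insert-sumFree (0∉S , a+b∉S) = 0∉insert , closed
      where
      0∉insert : insert v S 0v ≡ false
      0∉insert = insert-false 0v (λ 0v≡v → v≢0v (sym 0v≡v)) 0∉S
      ⊕v≢v : ∀ a → S a ≡ true → a ⊕ v ≢ v
      ⊕v≢v a sa a⊕v≡v = true≢false (trans (sym sa) (trans (cong S a≡0v) 0∉S))
        where
        a≡0v : a ≡ 0v
        a≡0v = trans (sym (⊕-cancelʳ a v)) (trans (cong (_⊕ v) a⊕v≡v) (⊕-self v))
      closed : ∀ a b → insert v S a ≡ true → insert v S b ≡ true → insert v S (a ⊕ b) ≡ false
      closed a b pa pb with insert-split a pa | insert-split b pb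
      ... | inj₁ a≡v | inj₁ b≡v =
        subst (λ w → insert v S w ≡ false) (sym (trans (cong₂ _⊕_ a≡v b≡v) (⊕-self v))) 0∉insert
      ... | inj₁ a≡v | inj₂ sb =
        subst (λ w → insert v S w ≡ false) (trans (⊕-comm b v) (cong (_⊕ b) (sym a≡v)))
              (insert-false (b ⊕ v) (⊕v≢v b sb) (no-pair b sb))
      ... | inj₂ sa | inj₁ b≡v =
        subst (λ w → insert v S w ≡ false) (cong (a ⊕_) (sym b≡v))
              (insert-false (a ⊕ v) (⊕v≢v a sa) (no-pair a sa))
      ... | inj₂ sa | inj₂ sb = insert-false (a ⊕ b) a⊕b≢v (a+b∉S a b sa sb)
        where
        a⊕b≢v : a ⊕ b ≢ v
        a⊕b≢v a⊕b≡v =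
          true≢false (trans (sym sb) (trans (cong S (trans (sym (⊕-cancelˡ a b)) (cong (a ⊕_) a⊕b≡v))) (no-pair a sa)))

    insert-shrinks : count (λ x → not (insert v S x)) < count (λ x → not (S x))
    insert-shrinks = begin-strict
      count (λ x → not (insert v S x))
        <⟨ m<m+n _ (1≤count (λ x → does (x ≟ᵥ v)) v (dec-true (v ≟ᵥ v) refl)) ⟩
      count (λ x → not (insert v S x)) + count (λ x → does (x ≟ᵥ v))
        ≡⟨ sym (∑-+ (𝟙 (λ x → not (insert v S x))) (𝟙 (λ x → does (x ≟ᵥ v)))) ⟩
      ∑ (λ x → 𝟙 (λ x → not (insert v S x)) x + 𝟙 (λ x → does (x ≟ᵥ v)) x)
        ≤⟨ ∑-mono pointwise ⟩
      count (λ x → not (S x)) ∎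
      where
      open ≤-Reasoning
      pointwise : ∀ x → 𝟙 (λ x → not (insert v S x)) x + 𝟙 (λ x → does (x ≟ᵥ v)) x ≤ 𝟙 (λ x → not (S x)) x
      pointwise x with x ≟ᵥ v
      ... | yes refl = ≤-reflexive (cong (λ b → if not b then 1 else 0) (sym v∉S))
      ... | no _ = ≤-reflexive (+-identityʳ _)

  extend : ∀ fuel (S : V m → Bool) → count (λ x → not (S x)) < fuel → SumFree S →
           Σ (V m → Bool) λ S' → (∀ x → S x ≡ true → S' x ≡ true) × SumFree S' × Spans S'
  extend (suc fuel) S bound sf with count (addable S) ≟ 0
  ... | yes saturated = S , (λ _ p → p) , sf , saturated⇒spans S saturated
  ... | no unsaturated =
    let v , v-addable = count-witness (addable S) (n≢0⇒n>0 unsaturated)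
        S' , ⊆S' , sf' , spans' = extend fuel (insert v S)
                                    (<-≤-trans (insert-shrinks S v v-addable) (≤-pred bound))
                                    (insert-sumFree S v v-addable sf)
    in S' , (λ x sx → ⊆S' x (⊆insert S v x sx)) , sf' , spans'

-- Greedily adding vectors that keep S sum-free ends in a maximal sum-free set,
-- and every vector outside a maximal one is a sum of two of its elements.
sumFree-spanning-extension : ∀ {m} {S : V m → Bool} → SumFree S →
  Σ (V m → Bool) λ S' → (∀ x → S x ≡ true → S' x ≡ true) × SumFree S' × Spans S'
sumFree-spanning-extension {S = S} = SumFreeExtension.extend (suc (count (λ x → not (S x)))) S ≤-refl

-- Density

SparseComplement : ∀ {n} → (V n → Bool) → ℕ → Set
SparseComplement {n} E s = count (λ x → not (E x)) * 2 ^ s < 3 * 2 ^ n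

private
  |E|+|Y| : ∀ {n} (E : V n → Bool) (s : ℕ) →
            2 ^ n * 2 ^ s ≡ count E * 2 ^ s + count (λ x → not (E x)) * 2 ^ s
  |E|+|Y| E s = trans (cong (_* 2 ^ s) (sym (count-complement E))) (*-distribʳ-+ (2 ^ s) (count E) (count (λ x → not (E x))))

denserThan⇒sparseComplement : (M : Matroid) (s : ℕ) → DenserThan M s → SparseComplement (E M) s
denserThan⇒sparseComplement M s dense =
  +-cancelˡ-< (count (E M) * 2 ^ s) _ _ (subst (_< count (E M) * 2 ^ s + 3 * 2 ^ r M) (|E|+|Y| (E M) s) dense)

sparseComplement⇒denserThan : (M : Matroid) (s : ℕ) → SparseComplement (E M) s → DenserThan M s
sparseComplement⇒denserThan M s sparse =
  subst (_< count (E M) * 2 ^ s + 3 * 2 ^ r M) (sym (|E|+|Y| (E M) s)) (+-monoʳ-< (count (E M) * 2 ^ s) sparse)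

-- Restriction to a hyperplane

module HyperplaneRestriction
  (s m : ℕ) (s≤m : s ≤ m)
  (E : V (suc m) → Bool) (0∉E : E 0v ≡ false) (noPG : ¬ ContainsPG E (suc s))
  (sparse : SparseComplement E (suc s))
  (unavoidable : ∀ k → k ≤ suc s → ¬ Avoids E k)
  (χ≤s : (M' : Matroid) → Free M' (PG s) → DenserThan M' s → ∀ k → IsCriticalNumber M' k → k ≤ s)
  {H : V (suc m) → Bool} (H-hyp : IsHyperplane H) (i : Fin (suc m)) (unit-i∉H : H (unit i) ≡ false)
  (few-outside : count (λ x → not (E x) ∧ not (H x)) < 2 ^ (m ∸ s))
  where

  open HyperplaneChart H-hyp i unit-i∉H
  open IsSubspace (proj₁ H-hyp) using (closed; has0)

  E∘j : V m → Bool
  E∘j u = E (j u)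

  0∉E∘j : E∘j 0v ≡ false
  0∉E∘j = trans (cong E (linear-0 j-linear)) 0∉E

  E∘j-PG-free : ¬ ContainsPG E∘j s
  E∘j-PG-free (ι , ι-lin , ι-E) = <-irrefl refl (begin-strict
    2 ^ m                         ≡⟨ sym |∁H| ⟩
    count (λ x → not (H x))       ≤⟨ outside-≤-cosets (proj₁ H-hyp) noPG (j∘ι , j∘ι-lin , ι-E) (λ u → j∈H (ι u)) ⟩
    2 ^ s * |Y∖H|                 ≡⟨ *-comm (2 ^ s) |Y∖H| ⟩
    |Y∖H| * 2 ^ s                 <⟨ *-monoˡ-< (2 ^ s) ⦃ m^n≢0 2 s ⦄ few-outside ⟩
    2 ^ (m ∸ s) * 2 ^ s           ≡⟨ sym (^-distribˡ-+-* 2 (m ∸ s) s) ⟩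
    2 ^ (m ∸ s + s)               ≡⟨ cong (2 ^_) (m∸n+n≡m s≤m) ⟩
    2 ^ m                         ∎)
    where
    open ≤-Reasoning
    |Y∖H| = count (λ x → not (E x) ∧ not (H x))
    j∘ι : V s → V (suc m)
    j∘ι u = j (ι u)
    j∘ι-lin : IsLinear j∘ι
    j∘ι-lin u u' = trans (cong j (ι-lin u u')) (j-linear (ι u) (ι u'))

  |Y∘j|·2ˢ<3·2ᵐ : count (λ u → not (E∘j u)) * 2 ^ s < 3 * 2 ^ m
  |Y∘j|·2ˢ<3·2ᵐ = *-cancelˡ-< 2 _ _ (begin-strict
    2 * (count (λ u → not (E∘j u)) * 2 ^ s) ≤⟨ *-monoʳ-≤ 2 (*-monoˡ-≤ (2 ^ s) |Y∘j|≤|Y|) ⟩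
    2 * (|Y| * 2 ^ s)                        ≡⟨ swap₂ |Y| (2 ^ s) ⟩
    |Y| * (2 * 2 ^ s)                        <⟨ sparse ⟩
    3 * (2 * 2 ^ m)                          ≡⟨ sym (swap₂ 3 (2 ^ m)) ⟩
    2 * (3 * 2 ^ m)                          ∎)
    where
    open ≤-Reasoning
    |Y| = count (λ x → not (E x))
    |Y∘j|≤|Y| : count (λ u → not (E∘j u)) ≤ |Y|
    |Y∘j|≤|Y| = ≤-trans (≤-reflexive (count-∘j (λ x → not (E x)))) (count-mono (λ x p → proj₂ (∧-true {H x} p)))
    swap₂ : ∀ a b → 2 * (a * b) ≡ a * (2 * b)
    swap₂ = solve-∀

  module _ (E' : V m → Bool) (E∘j⊆E' : ∀ u → E∘j u ≡ true → E' u ≡ true) where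

    lift-avoiding : ∀ k → Avoids E' k → Avoids E (suc k)
    lift-avoiding k (S , S-sub , S-codim , S∩E'=∅) = L , L-sub , L-codim , L∩E=∅
      where
      L : V (suc m) → Bool
      L x = H x ∧ S (π x)
      L-sub : IsSubspace L
      L-sub = record
        { has0 = cong₂ _∧_ has0 (trans (cong S (linear-0 π-linear)) (IsSubspace.has0 S-sub))
        ; closed = λ x y lx ly →
            let hx , sx = ∧-true {H x} lx ; hy , sy = ∧-true {H y} ly
            in cong₂ _∧_ (closed x y hx hy)
                         (trans (cong S (π-linear x y)) (IsSubspace.closed S-sub (π x) (π y) sx sy)) }
      |L| : count L ≡ count S
      |L| = trans (sym (count-∘j (λ x → S (π x)))) (count-cong (λ u → cong S (π∘j u)))
      L-codim : count L * 2 ^ suc k ≡ 2 ^ suc m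
      L-codim = begin
        count L * (2 * 2 ^ k) ≡⟨ cong (_* (2 * 2 ^ k)) |L| ⟩
        count S * (2 * 2 ^ k) ≡⟨ swap₂ (count S) (2 ^ k) ⟩
        2 * (count S * 2 ^ k) ≡⟨ cong (2 *_) S-codim ⟩
        2 * 2 ^ m             ∎
        where
        open ≡-Reasoning
        swap₂ : ∀ a b → a * (2 * b) ≡ 2 * (a * b)
        swap₂ = solve-∀
      L∩E=∅ : Disjoint L E
      L∩E=∅ x lx = ¬-not λ ex → true≢false
        (trans (sym (E∘j⊆E' (π x) (subst (λ w → E w ≡ true) (sym (j∘π x hx)) ex))) (S∩E'=∅ (π x) sx))
        where
        hx = proj₁ (∧-true {H x} lx)
        sx = proj₂ (∧-true {H x} lx)

    -- The hypothesis bounds χ(M') by s for the matroid M' on E', which lifts to a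
    -- subspace of codimension at most s + 1 avoiding E.
    no-dense-PG-free-extension : (0∉E' : E' 0v ≡ false) → Spans E' → ¬ ContainsPG E' s → ⊥
    no-dense-PG-free-extension 0∉E' E'-spans noPG' = critical-number-exists M' λ k χ →
      unavoidable (suc k) (s≤s (χ≤s M' M'-free M'-dense k χ)) (lift-avoiding k (proj₁ χ))
      where
      M' : Matroid
      M' = record { r = m ; E = E' ; zero∉E = 0∉E' ; spans = E'-spans }
      M'-free : Free M' (PG s)
      M'-free (ι , ι-lin , _ , ι-E') = noPG' (ι , ι-lin , ι-E')
      |Y'|≤|Y∘j| : count (λ u → not (E' u)) ≤ count (λ u → not (E∘j u))
      |Y'|≤|Y∘j| = count-mono λ u u∉E' →
        cong not (¬-not λ u∈E∘j → true≢false (trans (sym (E∘j⊆E' u u∈E∘j)) (not-injective u∉E')))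
      M'-dense : DenserThan M' s
      M'-dense = sparseComplement⇒denserThan M' s (≤-<-trans (*-monoˡ-≤ (2 ^ s) |Y'|≤|Y∘j|) |Y∘j|·2ˢ<3·2ᵐ)

  -- For s ≥ 3, fewer than 3·2ᵐ/8 vectors of F₂ᵐ lie outside E ∘ j, so E ∘ j itself spans.
  large-case : 3 ≤ s → ⊥
  large-case 3≤s = no-dense-PG-free-extension E∘j (λ _ p → p) 0∉E∘j (co-small⇒spans E∘j half) E∘j-PG-free
    where
    open ≤-Reasoning
    y = count (λ u → not (E∘j u))
    half : 2 * y < 2 ^ m
    half = *-cancelˡ-< 4 _ _ (begin-strict
      4 * (2 * y) ≡⟨ trans (sym (*-assoc 4 2 y)) (*-comm 8 y) ⟩
      y * 8       ≤⟨ *-monoʳ-≤ y (^-monoʳ-≤ 2 3≤s) ⟩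
      y * 2 ^ s   <⟨ |Y∘j|·2ˢ<3·2ᵐ ⟩
      3 * 2 ^ m   ≤⟨ *-monoˡ-≤ (2 ^ m) (n≤1+n 3) ⟩
      4 * 2 ^ m   ∎)

  -- For s = 2 a PG(1,2)-free set is sum-free, and E ∘ j is enlarged to a spanning one.
  triangle-case : s ≡ 2 → ⊥
  triangle-case refl =
    let E' , E∘j⊆E' , E'-sumFree , E'-spans = sumFree-spanning-extension (¬PG2⇒sumFree 0∉E∘j E∘j-PG-free)
    in no-dense-PG-free-extension E' E∘j⊆E' (proj₁ E'-sumFree) E'-spans (sumFree⇒¬PG2 E'-sumFree)

  contradiction : 2 ≤ s → ⊥
  contradiction 2≤s with m≤n⇒m<n∨m≡n 2≤s
  ... | inj₁ 2<s = large-case 2<s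
  ... | inj₂ 2≡s = triangle-case (sym 2≡s)

outside-hyperplane-bound :
  ∀ s n (E : V n → Bool) → 2 ≤ s → E 0v ≡ false → ¬ ContainsPG E (suc s) → SparseComplement E (suc s) →
  (∀ k → k ≤ suc s → ¬ Avoids E k) →
  ((M' : Matroid) → Free M' (PG s) → DenserThan M' s → ∀ k → IsCriticalNumber M' k → k ≤ s) →
  ∀ {H} → IsHyperplane H → 2 ^ (n ∸ suc s) ≤ count (λ x → not (E x) ∧ not (H x))
outside-hyperplane-bound s n E 2≤s 0∉E noPG sparse unavoidable χ≤s H-hyp with n ≤? suc s
... | yes n≤s+1 = ⊥-elim (unavoidable n n≤s+1 (zero-subspace-avoids 0∉E))
outside-hyperplane-bound s zero E 2≤s 0∉E noPG sparse unavoidable χ≤s H-hyp | no n≰s+1 = ⊥-elim (n≰s+1 z≤n)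
outside-hyperplane-bound s (suc m) E 2≤s 0∉E noPG sparse unavoidable χ≤s H-hyp | no n≰s+1 = ≮⇒≥ λ few →
  let i , unit-i∉H = hyperplane-misses-unit H-hyp
  in HyperplaneRestriction.contradiction s m (<⇒≤ (≤-pred (≰⇒> n≰s+1))) E 0∉E noPG sparse unavoidable χ≤s
                                         H-hyp i unit-i∉H few 2≤s

proposition2p1 : (t : ℕ) → 3 ≤ t →
    ((M' : Matroid) → Free M' (PG (t ∸ 1)) → DenserThan M' (t ∸ 1) →
      (k : ℕ) → IsCriticalNumber M' k → k ≡ t ∸ 2 ⊎ k ≡ t ∸ 1) →
    (M : Matroid) → Free M (PG t) → DenserThan M t →
    ((k : ℕ) → IsCriticalNumber M k → t < k) →
    (H : V (r M) → Bool) → IsHyperplane H →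
    2 ^ (r M ∸ t) ≤ ∣Y∖_∣ M H
proposition2p1 (suc s) 3≤t hyp M free dense χ>t H H-hyp =
  outside-hyperplane-bound s (r M) (E M) (≤-pred 3≤t) (zero∉E M) (λ c → free (containsPG⇒contains M c))
    (denserThan⇒sparseComplement M (suc s) dense) (unavoidable-below-critical M (suc s) χ>t) χ≤s H-hyp
  where
  χ≤s : (M' : Matroid) → Free M' (PG s) → DenserThan M' s → ∀ k → IsCriticalNumber M' k → k ≤ s
  χ≤s M' free' dense' k χ with hyp M' free' dense' k χ
  ... | inj₁ refl = m∸n≤m s 1
  ... | inj₂ refl = ≤-refl
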